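{- Let $\mathcal{F}$ be a TP-set system over a finite ground set $U$. Then $|\mathcal{F}|\le |U|+1$.
   Context: A set system $\mathcal{F}\subseteq 2^U$ over a ground set $U$ is a TP-set system if for every $X_1,X_2\in\mathcal{F}$ and every $x_1\in X_1\setminus X_2$, $x_2\in X_2\setminus X_1$, there is no $Y\in\mathcal{F}$ with $\{x_1,x_2\}\subseteq Y$. -}

module Defs where

open import Data.Nat using (ℕ)
open import Data.Fin using (Fin)
open import Data.Fin.Subset using (Subset; _∈_; _∉_)
open import Data.List using (List)
open import Data.List.Relation.Unary.Unique.Propositional using (Unique)
import Data.List.Membership.Propositional as LM
open import Data.Product using (_×_)
open import Relation.Nullary using (¬_)

-- A set system over the ground set U = Fin n is a duplicate-free list of
-- subsets of Fin n (its cardinality is the length of the list).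
record SetSystem (n : ℕ) : Set where
  field
    members : List (Subset n)
    distinct : Unique members

IsTP : {n : ℕ} → List (Subset n) → Set
IsTP {n} 𝓕 =
  ∀ (X₁ X₂ : Subset n) → X₁ LM.∈ 𝓕 → X₂ LM.∈ 𝓕 →
  ∀ (x₁ x₂ : Fin n) → x₁ ∈ X₁ → x₁ ∉ X₂ → x₂ ∈ X₂ → x₂ ∉ X₁ →
  ∀ (Y : Subset n) → Y LM.∈ 𝓕 → ¬ (x₁ ∈ Y × x₂ ∈ Y)

-- Split a TP-family over {0, …, n} by whether it contains 0. Deleting 0
-- from the members gives two duplicate-free families F₀ and F₁ of subsets of
-- {1, …, n}, and their union is again TP, so by induction it has at most
-- n + 1 members. The TP condition forces F₀ and F₁ to share at most one set:
-- if X and Z were both shared and i ∈ X ∖ Z, then 0 ∈ (Z ∪ {0}) ∖ X and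
-- i ∈ X ∖ (Z ∪ {0}) both lie in the member X ∪ {0}.
-- Hence |F| = |F₀| + |F₁| ≤ |F₀ ∪ F₁| + 1 ≤ n + 2.
module Submission where

open import Defs
open import Data.Bool using (Bool; true; false)
import Data.Bool.Properties as Bool
open import Data.Empty using (⊥-elim)
open import Data.Fin using (zero; suc)
open import Data.Fin.Subset using (Subset; _⊆_)
open import Data.Fin.Subset.Properties using (⊆-antisym) renaming (_∈?_ to _∈ₛ?_)
open import Data.List using (List; []; _∷_; length; filter; _++_)
open import Data.List.Properties using (length-++)
open import Data.List.Relation.Unary.All as All using (_∷_)
open import Data.List.Relation.Unary.AllPairs using ([]; _∷_)
open import Data.List.Relation.Unary.Any using (here; there)
open import Data.List.Relation.Unary.Unique.Propositional using (Unique)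
import Data.List.Relation.Unary.Unique.Propositional.Properties as Unique
import Data.List.Membership.Propositional as List
open import Data.List.Membership.Propositional.Properties using (∈-filter⁻; ∈-++⁻)
open import Data.Nat using (ℕ; zero; suc; _≤_; _+_; z≤n; s≤s)
open import Data.Nat.Properties using (+-suc; +-monoʳ-≤; +-monoˡ-≤; module ≤-Reasoning)
open import Data.Product using (∃; _,_; proj₁; proj₂)
open import Data.Sum using (inj₁; inj₂)
open import Data.Vec using ([]; _∷_; here; there)
open import Data.Vec.Properties using (≡-dec)
open import Level using (Level)
open import Relation.Nullary using (yes; no; does)
open import Relation.Nullary.Decidable using (decidable-stable)
open import Relation.Unary using (Pred; Decidable)
open import Relation.Unary.Properties using (∁?)
open import Relation.Binary.PropositionalEquality using (_≡_; refl; cong; sym; trans)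

private
  variable
    a p : Level
    A : Set a
    n : ℕ

length-filter-∁ : {P : Pred A p} (P? : Decidable P) (xs : List A) →
                  length xs ≡ length (filter P? xs) + length (filter (∁? P?) xs)
length-filter-∁ P? [] = refl
length-filter-∁ P? (x ∷ xs) with does (P? x)
... | true  = cong suc (length-filter-∁ P? xs)
... | false = trans (cong suc (length-filter-∁ P? xs)) (sym (+-suc _ _))

pairwise-equal⇒length≤1 : {xs : List A} → Unique xs →
                          (∀ {x y} → x List.∈ xs → y List.∈ xs → x ≡ y) → length xs ≤ 1
pairwise-equal⇒length≤1 {xs = []}        _              _  = z≤n
pairwise-equal⇒length≤1 {xs = _ ∷ []}    _              _  = s≤s z≤n
pairwise-equal⇒length≤1 {xs = _ ∷ _ ∷ _} ((x≢y ∷ _) ∷ _) eq =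
  ⊥-elim (x≢y (eq (here refl) (there (here refl))))

slice : Bool → List (Subset (suc n)) → List (Subset n)
slice b [] = []
slice b ((c ∷ X) ∷ 𝓕) with b Bool.≟ c
... | yes _ = X ∷ slice b 𝓕
... | no  _ = slice b 𝓕

∈-slice⁻ : ∀ b (𝓕 : List (Subset (suc n))) {X} → X List.∈ slice b 𝓕 → (b ∷ X) List.∈ 𝓕
∈-slice⁻ b ((c ∷ Y) ∷ 𝓕) X∈ with b Bool.≟ c | X∈
... | yes refl | here refl = here refl
... | yes refl | there X∈′ = there (∈-slice⁻ b 𝓕 X∈′)
... | no  _    | X∈′       = there (∈-slice⁻ b 𝓕 X∈′)

slice-unique : ∀ b {𝓕 : List (Subset (suc n))} → Unique 𝓕 → Unique (slice b 𝓕)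
slice-unique b {[]}            _              = []
slice-unique b {(c ∷ X) ∷ 𝓕} (X∉ ∷ unique) with b Bool.≟ c
... | yes refl = All.tabulate (λ Y∈ X≡Y → All.lookup X∉ (∈-slice⁻ b 𝓕 Y∈) (cong (b ∷_) X≡Y))
               ∷ slice-unique b unique
... | no  _    = slice-unique b unique

length-slices : (𝓕 : List (Subset (suc n))) →
                length 𝓕 ≡ length (slice false 𝓕) + length (slice true 𝓕)
length-slices [] = refl
length-slices ((false ∷ X) ∷ 𝓕) = cong suc (length-slices 𝓕)
length-slices ((true  ∷ X) ∷ 𝓕) = trans (cong suc (length-slices 𝓕)) (sym (+-suc _ _))

IsTP-tails : {𝓕 : List (Subset (suc n))} {𝓖 : List (Subset n)} → IsTP 𝓕 →
             (∀ {X} → X List.∈ 𝓖 → ∃ λ b → (b ∷ X) List.∈ 𝓕) → IsTP 𝓖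
IsTP-tails tp extend X₁ X₂ X₁∈ X₂∈ x₁ x₂ x₁∈X₁ x₁∉X₂ x₂∈X₂ x₂∉X₁ Y Y∈ (x₁∈Y , x₂∈Y)
  with extend X₁∈ | extend X₂∈ | extend Y∈
... | b₁ , X₁′∈ | b₂ , X₂′∈ | c , Y′∈ =
  tp (b₁ ∷ X₁) (b₂ ∷ X₂) X₁′∈ X₂′∈ (suc x₁) (suc x₂)
     (there x₁∈X₁) (λ { (there x₁∈X₂) → x₁∉X₂ x₁∈X₂ })
     (there x₂∈X₂) (λ { (there x₂∈X₁) → x₂∉X₁ x₂∈X₁ })
     (c ∷ Y) Y′∈ (there x₁∈Y , there x₂∈Y)

module _ {𝓕 : List (Subset (suc n))} (tp : IsTP 𝓕) where

  shared-slice-⊆ : ∀ {X Z} → X List.∈ slice false 𝓕 → X List.∈ slice true 𝓕 →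
                   Z List.∈ slice true 𝓕 → X ⊆ Z
  shared-slice-⊆ {X} {Z} X∈₀ X∈₁ Z∈₁ {i} i∈X = decidable-stable (i ∈ₛ? Z) λ i∉Z →
    tp (true ∷ Z) (false ∷ X) (∈-slice⁻ true 𝓕 Z∈₁) (∈-slice⁻ false 𝓕 X∈₀)
       zero (suc i) here (λ ()) (there i∈X) (λ { (there i∈Z) → i∉Z i∈Z })
       (true ∷ X) (∈-slice⁻ true 𝓕 X∈₁) (here , there i∈X)

  shared-slice-unique : ∀ {X Z} →
                        X List.∈ slice false 𝓕 → X List.∈ slice true 𝓕 →
                        Z List.∈ slice false 𝓕 → Z List.∈ slice true 𝓕 → X ≡ Z
  shared-slice-unique X∈₀ X∈₁ Z∈₀ Z∈₁ =
    ⊆-antisym (shared-slice-⊆ X∈₀ X∈₁ Z∈₁) (shared-slice-⊆ Z∈₀ Z∈₁ X∈₁)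

IsTP⇒length≤n+1 : ∀ n (𝓕 : List (Subset n)) → Unique 𝓕 → IsTP 𝓕 → length 𝓕 ≤ n + 1
IsTP⇒length≤n+1 zero 𝓕 unique _ = pairwise-equal⇒length≤1 unique λ { {[]} {[]} _ _ → refl }
IsTP⇒length≤n+1 (suc n) 𝓕 unique tp = begin
  length 𝓕                           ≡⟨ length-slices 𝓕 ⟩
  length 𝓕₀ + length 𝓕₁              ≡⟨ cong (length 𝓕₀ +_) (length-filter-∁ (_∈? 𝓕₀) 𝓕₁) ⟩
  length 𝓕₀ + (length 𝓢 + length 𝓡)  ≤⟨ +-monoʳ-≤ (length 𝓕₀) (+-monoˡ-≤ (length 𝓡) length𝓢≤1) ⟩
  length 𝓕₀ + suc (length 𝓡)         ≡⟨ +-suc (length 𝓕₀) (length 𝓡) ⟩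
  suc (length 𝓕₀ + length 𝓡)         ≡⟨ cong suc (length-++ 𝓕₀) ⟨
  suc (length 𝓖)                      ≤⟨ s≤s (IsTP⇒length≤n+1 n 𝓖 unique𝓖 (IsTP-tails tp extend)) ⟩
  suc n + 1                           ∎
  where
  open ≤-Reasoning
  open import Data.List.Membership.DecPropositional (≡-dec Bool._≟_) using (_∈?_)
  𝓕₀ 𝓕₁ 𝓢 𝓡 𝓖 : List (Subset n)
  𝓕₀ = slice false 𝓕
  𝓕₁ = slice true 𝓕
  𝓢 = filter (_∈? 𝓕₀) 𝓕₁
  𝓡 = filter (∁? (_∈? 𝓕₀)) 𝓕₁
  𝓖 = 𝓕₀ ++ 𝓡

  length𝓢≤1 : length 𝓢 ≤ 1
  length𝓢≤1 =
    pairwise-equal⇒length≤1 (Unique.filter⁺ (_∈? 𝓕₀) (slice-unique true unique)) λ X∈ Z∈ →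
      let X∈₁ , X∈₀ = ∈-filter⁻ (_∈? 𝓕₀) X∈
          Z∈₁ , Z∈₀ = ∈-filter⁻ (_∈? 𝓕₀) Z∈
      in shared-slice-unique tp X∈₀ X∈₁ Z∈₀ Z∈₁

  unique𝓖 : Unique 𝓖
  unique𝓖 = Unique.++⁺ (slice-unique false unique)
                       (Unique.filter⁺ (∁? (_∈? 𝓕₀)) (slice-unique true unique))
                       λ (X∈₀ , X∈𝓡) → proj₂ (∈-filter⁻ (∁? (_∈? 𝓕₀)) {xs = 𝓕₁} X∈𝓡) X∈₀

  extend : ∀ {X} → X List.∈ 𝓖 → ∃ λ b → (b ∷ X) List.∈ 𝓕
  extend X∈ with ∈-++⁻ 𝓕₀ X∈
  ... | inj₁ X∈₀ = false , ∈-slice⁻ false 𝓕 X∈₀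
  ... | inj₂ X∈𝓡 = true , ∈-slice⁻ true 𝓕 (proj₁ (∈-filter⁻ (∁? (_∈? 𝓕₀)) X∈𝓡))

lemma2 : ∀ (n : ℕ) (𝓕 : SetSystem n) → IsTP (SetSystem.members 𝓕) →
         length (SetSystem.members 𝓕) ≤ n + 1
lemma2 n 𝓕 = IsTP⇒length≤n+1 n (SetSystem.members 𝓕) (SetSystem.distinct 𝓕)
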